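{- No Go-diagram contains a rectangular block of boxes (consecutive rows and consecutive columns, at least two of each) in which the top-left box contains a white stone or a plus, the top-right box contains a black stone or a plus, the bottom-left box contains a black stone or a plus, the bottom-right box contains a white stone, and every other box of the block contains a white stone.
   Context: Fix $0<k<n$. A Ferrers shape $\lambda$ is the set of unit boxes Northwest of a lattice path from the Northeast to the Southwest corner of a $k$-row, $(n-k)$-column rectangle; path steps labelled $1,\dots,n$ from the Northeast corner. $b^{in}$ is the set of boxes weakly right of and weakly below $b$. A $\bullet/\circ/+$-diagram fills the boxes with black stones, white stones and pluses. $s_i=(i,i+1)\in\mathfrak S_n$; the top-left box is labelled $s_{n-k}$; the box right of an $s_i$-box is labelled $s_{i-1}$, the box below it $s_{i+1}$; $s_b$ is $b$'s label. A reading order numbers boxes increasing upward and leftward. $u_{b^{in}}$ is the product of $s_c$ over boxes $c\in b^{in}$ containing stones, in increasing reading order; $u_b=s_b$ if $b$ contains a stone, else the identity; $\ell$ is Coxeter length. $D$ is a Go-diagram if for every box $b$: $b$ contains a black stone iff $\ell(u_{b^{in}}u_bs_b)<\ell(u_{b^{in}}u_b)$. -}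

module Defs where

open import Data.Nat using (ℕ; zero; suc; _+_; _∸_; _≤_; _<_; _≤?_; _<ᵇ_)
open import Data.Bool using (Bool; true; false; if_then_else_)
open import Data.List using (List; []; _∷_; upTo; downFrom; filter; concatMap; map; foldl; length)
open import Data.Product using (_×_; _,_)
open import Relation.Binary.PropositionalEquality using (_≡_)

data Content : Set where
  black white plus : Content

hasStone : Content → Bool
hasStone black = true
hasStone white = true
hasStone plus  = false

-- Symmetric group S_n in one-line notation (a list of length n of the
-- values 0,…,n-1).  The identity of S_n is upTo n.
Perm : Set
Perm = List ℕ

idPerm : ℕ → Perm
idPerm n = upTo n

swapAt : ℕ → List ℕ → List ℕ
swapAt zero    (x ∷ y ∷ xs) = y ∷ x ∷ xs
swapAt (suc p) (x ∷ xs)     = x ∷ swapAt p xs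
swapAt _       xs           = xs

-- right multiplication  w ↦ w s_l  where s_l = (l, l+1), 1 ≤ l ≤ n-1
-- (transposes the entries in positions l and l+1, 1-indexed)
_·s_ : Perm → ℕ → Perm
w ·s l = swapAt (l ∸ 1) w

-- Coxeter length in S_n = number of inversions
countLess : ℕ → List ℕ → ℕ
countLess x []       = 0
countLess x (y ∷ ys) = if y <ᵇ x then suc (countLess x ys) else countLess x ys

len : Perm → ℕ
len []       = 0
len (x ∷ xs) = countLess x xs + len xs

-- Ferrers shape inside a k-row, m-column rectangle (m = n - k), given by
-- its row lengths (rows indexed 0,…,k-1 from the top; row i ≥ k empty).
-- Box (i , j) (row i, column j, 0-indexed from the top-left) lies in the
-- shape iff j < row i.
record Shape (k m : ℕ) : Set where
  field
    row       : ℕ → ℕ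
    row-bound : ∀ i → row i ≤ m
    row-mono  : ∀ i → row (suc i) ≤ row i
    row-empty : ∀ i → k ≤ i → row i ≡ 0
open Shape public

InShape : ∀ {k m} → Shape k m → ℕ → ℕ → Set
InShape sh i j = j < row sh i

-- a filling of the boxes (values outside the shape are irrelevant)
Diagram : Set
Diagram = ℕ → ℕ → Content

-- label of box (i , j): top-left is s_m, moving right decreases the index
-- by one, moving down increases it by one.  We record the index m - j + i.
label : ℕ → ℕ → ℕ → ℕ
label m i j = (m ∸ j) + i

-- The boxes of b^in for b = (i , j) (boxes of the shape weakly below and
-- weakly right of b, including b), listed in increasing reading order:
-- rows from the bottom row upwards, each row from right to left.
boxesIn : ∀ {k m} → Shape k m → ℕ → ℕ → List (ℕ × ℕ)
boxesIn {k} sh i j =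
  concatMap (λ i' → map (λ j' → (i' , j')) (filter (j ≤?_) (downFrom (row sh i'))))
            (filter (i ≤?_) (downFrom k))

-- u_{b^in} : product of s_c over stone-boxes c of b^in, increasing reading order
uIn : (n k : ℕ) → Shape k (n ∸ k) → Diagram → ℕ → ℕ → Perm
uIn n k sh D i j =
  foldl (λ w c → step w c) (idPerm n) (boxesIn sh i j)
  where
  step : Perm → ℕ × ℕ → Perm
  step w (i' , j') = if hasStone (D i' j') then w ·s label (n ∸ k) i' j' else w

uInB : (n k : ℕ) → Shape k (n ∸ k) → Diagram → ℕ → ℕ → Perm
uInB n k sh D i j =
  if hasStone (D i j) then uIn n k sh D i j ·s label (n ∸ k) i j
  else uIn n k sh D i j

IsGoDiagram : (n k : ℕ) → Shape k (n ∸ k) → Diagram → Set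
IsGoDiagram n k sh D =
  ∀ i j → InShape sh i j →
    let w = uInB n k sh D i j
        s = label (n ∸ k) i j
    in (D i j ≡ black → len (w ·s s) < len w)
     × (len (w ·s s) < len w → D i j ≡ black)

-- Read the products u_{b^in} as a wiring diagram. If s_b swaps positions p and p + 1,
-- call the entries of u_{b^in} u_b in these positions the values arriving at b from the
-- right and from below: they are the values leaving b's right and lower neighbours. A
-- stone lets both values pass straight through, a plus turns them, and the Go condition
-- says that b is black exactly when the value from below is the smaller one.
-- In the forbidden block the value x arriving at the white bottom-right corner from the
-- right comes straight along the bottom row, and the value y arriving from below goes
-- straight up the right column; whiteness gives x < y. A black-or-plus top-right corner
-- forces y to be at most the value that then travels along the top row into the top-left
-- corner, and a black-or-plus bottom-left corner forces the value going up the left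
-- column into the top-left corner to be at most x. So the top-left corner is black.

module Submission where

open import Defs
open import Data.Bool using (true; false; if_then_else_)
open import Data.Bool using () renaming (T to IsTrue)
open import Data.List using (List; []; _∷_; _++_; [_]; upTo; downFrom; filter; concatMap; map; foldl; take; length)
open import Data.List.Properties using (filter-accept; filter-reject; take-take; foldl-++; concatMap-++; ++-identityʳ; length-upTo; map-++)
open import Data.List.Relation.Unary.All as All using (All; []; _∷_)
open import Data.List.Relation.Unary.All.Properties using (all-filter; filter⁺; applyDownFrom⁺₁; map⁺)
open import Data.List.Relation.Unary.AllPairs using (_∷_)
open import Data.List.Relation.Unary.Unique.Propositional using (Unique)
open import Data.List.Relation.Unary.Unique.Propositional.Properties using (upTo⁺)
open import Data.Nat using (ℕ; zero; suc; _+_; _∸_; _⊓_; _≤_; _<_; _<ᵇ_; z≤n; s≤s; z<s)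
open import Data.Nat.Properties
open import Algebra.Properties.CommutativeSemigroup +-commutativeSemigroup using (x∙yz≈y∙xz)
open import Data.Product using (_×_; _,_; proj₁; proj₂; Σ-syntax)
open import Data.Sum using (_⊎_; inj₁; inj₂)
open import Data.Unit using (tt)
open import Function using (id; _∘_; _$_)
open import Function.Bundles using (_⇔_; mk⇔; Equivalence)
open import Relation.Nullary using (¬_; yes; no; contradiction)
open import Relation.Binary.PropositionalEquality hiding ([_])

-- 0 past the end of the list.
at : List ℕ → ℕ → ℕ
at []       _       = 0
at (x ∷ xs) zero    = x
at (x ∷ xs) (suc q) = at xs q

at-take : ∀ T q w → q < T → at (take T w) q ≡ at w q
at-take (suc T) q       []       _         = refl
at-take (suc T) zero    (x ∷ xs) _         = refl
at-take (suc T) (suc q) (x ∷ xs) (s≤s q<T) = at-take T q xs q<T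

take-≤-cong : ∀ {T T′} {w w′ : List ℕ} → T′ ≤ T → take T w ≡ take T w′ → take T′ w ≡ take T′ w′
take-≤-cong {T} {T′} {w} {w′} T′≤T eq = begin
  take T′ w           ≡⟨ cong (λ t → take t w) (m≤n⇒m⊓n≡m T′≤T) ⟨
  take (T′ ⊓ T) w     ≡⟨ take-take T′ T w ⟨
  take T′ (take T w)  ≡⟨ cong (take T′) eq ⟩
  take T′ (take T w′) ≡⟨ take-take T′ T w′ ⟩
  take (T′ ⊓ T) w′    ≡⟨ cong (λ t → take t w′) (m≤n⇒m⊓n≡m T′≤T) ⟩
  take T′ w′          ∎
  where open ≡-Reasoning

swapAt-involutive : ∀ p w → swapAt p (swapAt p w) ≡ w
swapAt-involutive zero    []           = refl
swapAt-involutive zero    (x ∷ [])     = refl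
swapAt-involutive zero    (x ∷ y ∷ xs) = refl
swapAt-involutive (suc p) []           = refl
swapAt-involutive (suc p) (x ∷ xs)     = cong (x ∷_) (swapAt-involutive p xs)

length-swapAt : ∀ p w → length (swapAt p w) ≡ length w
length-swapAt zero    []           = refl
length-swapAt zero    (x ∷ [])     = refl
length-swapAt zero    (x ∷ y ∷ xs) = refl
length-swapAt (suc p) []           = refl
length-swapAt (suc p) (x ∷ xs)     = cong suc (length-swapAt p xs)

at-swapAt-beyond : ∀ p q w → suc p < q → at (swapAt p w) q ≡ at w q
at-swapAt-beyond zero    (suc zero)    w            (s≤s ())
at-swapAt-beyond zero    (suc (suc q)) []           _         = refl
at-swapAt-beyond zero    (suc (suc q)) (x ∷ [])     _         = refl
at-swapAt-beyond zero    (suc (suc q)) (x ∷ y ∷ xs) _         = refl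
at-swapAt-beyond (suc p) q             []           _         = refl
at-swapAt-beyond (suc p) (suc q)       (x ∷ xs)     (s≤s p<q) = at-swapAt-beyond p q xs p<q

at-swapAt : ∀ p w → suc p < length w → at (swapAt p w) p ≡ at w (suc p)
at-swapAt zero    (x ∷ [])     (s≤s ())
at-swapAt zero    (x ∷ y ∷ xs) _         = refl
at-swapAt (suc p) (x ∷ xs)     (s≤s p<l) = at-swapAt p xs p<l

at-swapAt-suc : ∀ p w → suc p < length w → at (swapAt p w) (suc p) ≡ at w p
at-swapAt-suc zero    (x ∷ [])     (s≤s ())
at-swapAt-suc zero    (x ∷ y ∷ xs) _         = refl
at-swapAt-suc (suc p) (x ∷ xs)     (s≤s p<l) = at-swapAt-suc p xs p<l

take-swapAt : ∀ p T w → suc p < T → take T (swapAt p w) ≡ swapAt p (take T w)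
take-swapAt zero    (suc zero)    w            (s≤s ())
take-swapAt zero    (suc (suc T)) []           _         = refl
take-swapAt zero    (suc (suc T)) (x ∷ [])     _         = refl
take-swapAt zero    (suc (suc T)) (x ∷ y ∷ xs) _         = refl
take-swapAt (suc p) (suc T)       []           _         = refl
take-swapAt (suc p) (suc T)       (x ∷ xs)     (s≤s p<T) = cong (x ∷_) (take-swapAt p T xs p<T)

take-swapAt-beyond : ∀ p T w → T ≤ p → take T (swapAt p w) ≡ take T w
take-swapAt-beyond p       zero    w        _         = refl
take-swapAt-beyond (suc p) (suc T) []       _         = refl
take-swapAt-beyond (suc p) (suc T) (x ∷ xs) (s≤s T≤p) = cong (x ∷_) (take-swapAt-beyond p T xs T≤p)

All-swapAt : ∀ {P : ℕ → Set} p w → All P w → All P (swapAt p w)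
All-swapAt zero    []           ps               = ps
All-swapAt zero    (x ∷ [])     ps               = ps
All-swapAt zero    (x ∷ y ∷ xs) (px ∷ py ∷ ps)   = py ∷ px ∷ ps
All-swapAt (suc p) []           ps               = ps
All-swapAt (suc p) (x ∷ xs)     (px ∷ ps)        = px ∷ All-swapAt p xs ps

Unique-swapAt : ∀ p w → Unique w → Unique (swapAt p w)
Unique-swapAt zero    []           u                             = u
Unique-swapAt zero    (x ∷ [])     u                             = u
Unique-swapAt zero    (x ∷ y ∷ xs) ((x≢y ∷ x∉xs) ∷ y∉xs ∷ u)      = (≢-sym x≢y ∷ y∉xs) ∷ x∉xs ∷ u
Unique-swapAt (suc p) []           u                             = u
Unique-swapAt (suc p) (x ∷ xs)     (x∉xs ∷ u)                    = All-swapAt p xs x∉xs ∷ Unique-swapAt p xs u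

Unique⇒at≢at-suc : ∀ p w → Unique w → suc p < length w → at w p ≢ at w (suc p)
Unique⇒at≢at-suc zero    (x ∷ [])     _               (s≤s ())
Unique⇒at≢at-suc zero    (x ∷ y ∷ xs) ((x≢y ∷ _) ∷ _) _         = x≢y
Unique⇒at≢at-suc (suc p) (x ∷ xs)     (_ ∷ u)         (s≤s p<l) = Unique⇒at≢at-suc p xs u p<l

countLess-swapAt : ∀ x p w → countLess x (swapAt p w) ≡ countLess x w
countLess-swapAt x zero    []           = refl
countLess-swapAt x zero    (a ∷ [])     = refl
countLess-swapAt x zero    (a ∷ b ∷ ws) with a <ᵇ x | b <ᵇ x
... | true  | true  = refl
... | true  | false = refl
... | false | true  = refl
... | false | false = refl
countLess-swapAt x (suc p) []       = refl
countLess-swapAt x (suc p) (a ∷ ws) with a <ᵇ x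
... | true  = cong suc (countLess-swapAt x p ws)
... | false = countLess-swapAt x p ws

<ᵇ≡true⇒< : ∀ {m n} → (m <ᵇ n) ≡ true → m < n
<ᵇ≡true⇒< {m} {n} eq = <ᵇ⇒< m n (subst IsTrue (sym eq) tt)

<ᵇ≡false⇒≮ : ∀ {m n} → (m <ᵇ n) ≡ false → ¬ m < n
<ᵇ≡false⇒≮ eq m<n = subst IsTrue eq (<⇒<ᵇ m<n)

-- Swapping two adjacent entries changes only whether that pair is an inversion.
len-swap-head : ∀ x y xs → len (y ∷ x ∷ xs) < len (x ∷ y ∷ xs) ⇔ y < x
len-swap-head x y xs with x <ᵇ y in xy | y <ᵇ x in yx | x∙yz≈y∙xz (countLess y xs) (countLess x xs) (len xs)
... | true  | true  | _       = contradiction (<ᵇ≡true⇒< yx) (<-asym (<ᵇ≡true⇒< {x} {y} xy))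
... | true  | false | swapped = mk⇔ (λ lt → contradiction lt (≤⇒≯ (≤-trans (≤-reflexive (sym swapped)) (n≤1+n _))))
                                    (λ y<x → contradiction y<x (<ᵇ≡false⇒≮ yx))
... | false | true  | swapped = mk⇔ (λ _ → <ᵇ≡true⇒< yx) (λ _ → s≤s (≤-reflexive swapped))
... | false | false | swapped = mk⇔ (λ lt → contradiction swapped (<⇒≢ lt)) (λ y<x → contradiction y<x (<ᵇ≡false⇒≮ yx))

len-swapAt<⇔descent : ∀ p w → suc p < length w → len (swapAt p w) < len w ⇔ at w (suc p) < at w p
len-swapAt<⇔descent zero    (x ∷ [])     (s≤s ())
len-swapAt<⇔descent zero    (x ∷ y ∷ xs) _         = len-swap-head x y xs
len-swapAt<⇔descent (suc p) (x ∷ xs)     (s≤s p<l) = mk⇔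
  (Equivalence.to tail ∘ +-cancelˡ-< (countLess x xs) _ _ ∘ subst (λ c → c + _ < _) (countLess-swapAt x p xs))
  (subst (λ c → c + _ < _) (sym (countLess-swapAt x p xs)) ∘ +-monoʳ-< (countLess x xs) ∘ Equivalence.from tail)
  where tail = len-swapAt<⇔descent p xs p<l

filter-≤-downFrom-≤ : ∀ j R → R ≤ j → filter (j ≤?_) (downFrom R) ≡ []
filter-≤-downFrom-≤ j zero    _   = refl
filter-≤-downFrom-≤ j (suc R) R<j = begin
  filter (j ≤?_) (R ∷ downFrom R) ≡⟨ filter-reject (j ≤?_) (<⇒≱ R<j) ⟩
  filter (j ≤?_) (downFrom R)     ≡⟨ filter-≤-downFrom-≤ j R (<⇒≤ R<j) ⟩
  []                              ∎
  where open ≡-Reasoning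

filter-≤-downFrom-< : ∀ j R → j < R → filter (j ≤?_) (downFrom R) ≡ filter (suc j ≤?_) (downFrom R) ++ [ j ]
filter-≤-downFrom-< j (suc R) (s≤s j≤R) with m≤n⇒m<n∨m≡n j≤R
... | inj₁ j<R = begin
  filter (j ≤?_) (R ∷ downFrom R)              ≡⟨ filter-accept (j ≤?_) j≤R ⟩
  R ∷ filter (j ≤?_) (downFrom R)              ≡⟨ cong (R ∷_) (filter-≤-downFrom-< j R j<R) ⟩
  R ∷ filter (suc j ≤?_) (downFrom R) ++ [ j ] ≡⟨ cong (_++ [ j ]) (filter-accept (suc j ≤?_) j<R) ⟨
  filter (suc j ≤?_) (R ∷ downFrom R) ++ [ j ] ∎
  where open ≡-Reasoning
... | inj₂ refl = begin
  filter (j ≤?_) (j ∷ downFrom j)              ≡⟨ filter-accept (j ≤?_) ≤-refl ⟩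
  j ∷ filter (j ≤?_) (downFrom j)              ≡⟨ cong (j ∷_) (filter-≤-downFrom-≤ j j ≤-refl) ⟩
  [ j ]                                        ≡⟨ cong (_++ [ j ]) (filter-≤-downFrom-≤ (suc j) (suc j) ≤-refl) ⟨
  filter (suc j ≤?_) (j ∷ downFrom j) ++ [ j ] ∎
  where open ≡-Reasoning

All-filter-≤-downFrom : ∀ {P : ℕ → Set} j R → (∀ {x} → j ≤ x → x < R → P x) → All P (filter (j ≤?_) (downFrom R))
All-filter-≤-downFrom j R f =
  All.map (λ (j≤x , x<R) → f j≤x x<R) (All.zip (all-filter (j ≤?_) (downFrom R) , filter⁺ (j ≤?_) (applyDownFrom⁺₁ id R id)))

m>n⇒m∸n≡suc[m∸suc[n]] : ∀ {m n} → n < m → m ∸ n ≡ suc (m ∸ suc n)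
m>n⇒m∸n≡suc[m∸suc[n]] {suc m} {zero}  _         = refl
m>n⇒m∸n≡suc[m∸suc[n]] {suc m} {suc n} (s≤s n<m) = m>n⇒m∸n≡suc[m∸suc[n]] n<m

row-antitone : ∀ {k m} (sh : Shape k m) {i i′} → i ≤ i′ → row sh i′ ≤ row sh i
row-antitone sh {i′ = zero}   z≤n = ≤-refl
row-antitone sh {i′ = suc i′} i≤ with m≤n⇒m<n∨m≡n i≤
... | inj₁ (s≤s i≤i′) = ≤-trans (row-mono sh i′) (row-antitone sh i≤i′)
... | inj₂ refl       = ≤-refl

InShape-upLeft : ∀ {k m} (sh : Shape k m) {i i′ j j′} → i ≤ i′ → j ≤ j′ → InShape sh i′ j′ → InShape sh i j
InShape-upLeft sh i≤i′ j≤j′ inShape = ≤-<-trans j≤j′ (<-≤-trans inShape (row-antitone sh i≤i′))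

InShape⇒row<k : ∀ {k m} (sh : Shape k m) {i j} → InShape sh i j → i < k
InShape⇒row<k {k} sh {i} inShape with k ≤? i
... | yes k≤i = contradiction (subst (_ <_) (row-empty sh i k≤i) inShape) λ ()
... | no  k≰i = ≰⇒> k≰i

InShape⇒col<m : ∀ {k m} (sh : Shape k m) {i j} → InShape sh i j → j < m
InShape⇒col<m sh {i} inShape = <-≤-trans inShape (row-bound sh i)

BlackOrPlus : Content → Set
BlackOrPlus x = x ≡ black ⊎ x ≡ plus

whiteOrPlus⇒≢black : ∀ {x} → x ≡ white ⊎ x ≡ plus → x ≢ black
whiteOrPlus⇒≢black (inj₁ refl) ()
whiteOrPlus⇒≢black (inj₂ refl) ()

module Wiring (n k : ℕ) (k≤n : k ≤ n) (sh : Shape k (n ∸ k)) (D : Diagram) where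

  m : ℕ
  m = n ∸ k

  Stone : ℕ → ℕ → Set
  Stone i j = hasStone (D i j) ≡ true

  pos : ℕ × ℕ → ℕ
  pos (i , j) = label m i j ∸ 1

  gap : ℕ → ℕ
  gap j = m ∸ suc j

  step : Perm → ℕ × ℕ → Perm
  step w (i , j) = if hasStone (D i j) then w ·s label m i j else w

  segment : ℕ → ℕ → List (ℕ × ℕ)
  segment i j = map (i ,_) (filter (j ≤?_) (downFrom (row sh i)))

  boxesFrom : ℕ → ℕ → List (ℕ × ℕ)
  boxesFrom i j = concatMap (λ i′ → segment i′ j) (filter (i ≤?_) (downFrom k))

  -- For the box b = (i , j): u i j is u_{b^in}, and uBefore i j, the product over b^in
  -- without b, is u_{b^in} u_b (uInB≡uBefore). s_b swaps the 0-indexed positions pos b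
  -- and suc (pos b).
  u : ℕ → ℕ → Perm
  u i j = foldl step (upTo n) (boxesFrom i j)

  uBefore : ℕ → ℕ → Perm
  uBefore i j = foldl step (u (suc i) j) (segment i (suc j))

  fromRight fromBelow : ℕ → ℕ → ℕ
  fromRight i j = at (uBefore i j) (pos (i , j))
  fromBelow i j = at (uBefore i j) (suc (pos (i , j)))

  pos≡gap+row : ∀ {i j} → j < m → pos (i , j) ≡ gap j + i
  pos≡gap+row {i} j<m = cong (λ g → g + i ∸ 1) (m>n⇒m∸n≡suc[m∸suc[n]] j<m)

  suc-pos<n : ∀ {i j} → InShape sh i j → suc (pos (i , j)) < n
  suc-pos<n {i} {j} inShape = begin-strict
    suc (pos (i , j)) ≡⟨ cong suc (pos≡gap+row j<m) ⟩
    suc (gap j) + i   ≡⟨ cong (_+ i) (m>n⇒m∸n≡suc[m∸suc[n]] j<m) ⟨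
    m ∸ j + i         ≤⟨ +-monoˡ-≤ i (m∸n≤m m j) ⟩
    m + i             <⟨ +-monoʳ-< m (InShape⇒row<k sh inShape) ⟩
    m + k             ≡⟨ m∸n+n≡m k≤n ⟩
    n                 ∎
    where open ≤-Reasoning
          j<m = InShape⇒col<m sh inShape

  segment-left-of : ∀ i j → All (λ b → suc (pos b) ≤ gap j + i) (segment i (suc j))
  segment-left-of i j = map⁺ (All-filter-≤-downFrom (suc j) (row sh i) bound)
    where
    bound : ∀ {j′} → suc j ≤ j′ → j′ < row sh i → suc (pos (i , j′)) ≤ gap j + i
    bound {j′} j<j′ j′<row = begin
      suc (pos (i , j′)) ≡⟨ cong suc (pos≡gap+row j′<m) ⟩
      suc (gap j′) + i   ≡⟨ cong (_+ i) (m>n⇒m∸n≡suc[m∸suc[n]] j′<m) ⟨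
      m ∸ j′ + i         ≤⟨ +-monoˡ-≤ i (∸-monoʳ-≤ m j<j′) ⟩
      gap j + i          ∎
      where open ≤-Reasoning
            j′<m = <-≤-trans j′<row (row-bound sh i)

  step-involutive : ∀ w b → step (step w b) b ≡ w
  step-involutive w (i , j) with hasStone (D i j)
  ... | true  = swapAt-involutive (pos (i , j)) w
  ... | false = refl

  length-foldl-step : ∀ w bs → length (foldl step w bs) ≡ length w
  length-foldl-step w []             = refl
  length-foldl-step w ((i , j) ∷ bs) with hasStone (D i j)
  ... | true  = trans (length-foldl-step _ bs) (length-swapAt (pos (i , j)) w)
  ... | false = length-foldl-step w bs

  Unique-foldl-step : ∀ w bs → Unique w → Unique (foldl step w bs)
  Unique-foldl-step w []             uniq = uniq
  Unique-foldl-step w ((i , j) ∷ bs) uniq with hasStone (D i j)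
  ... | true  = Unique-foldl-step _ bs (Unique-swapAt (pos (i , j)) w uniq)
  ... | false = Unique-foldl-step w bs uniq

  take-foldl-step : ∀ {T} w bs → All (λ b → suc (pos b) < T) bs → take T (foldl step w bs) ≡ foldl step (take T w) bs
  take-foldl-step w []             []        = refl
  take-foldl-step w ((i , j) ∷ bs) (p<T ∷ ps) with hasStone (D i j)
  ... | true  = trans (take-foldl-step _ bs ps) (cong (λ v → foldl step v bs) (take-swapAt (pos (i , j)) _ w p<T))
  ... | false = take-foldl-step w bs ps

  at-foldl-step-beyond : ∀ {q} w bs → All (λ b → suc (pos b) < q) bs → at (foldl step w bs) q ≡ at w q
  at-foldl-step-beyond w []             []         = refl
  at-foldl-step-beyond w ((i , j) ∷ bs) (p<q ∷ ps) with hasStone (D i j)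
  ... | true  = trans (at-foldl-step-beyond _ bs ps) (at-swapAt-beyond (pos (i , j)) _ w p<q)
  ... | false = at-foldl-step-beyond w bs ps

  segment-empty : ∀ {i j} → row sh i ≤ j → segment i j ≡ []
  segment-empty {i} {j} row≤j = cong (map (i ,_)) (filter-≤-downFrom-≤ j (row sh i) row≤j)

  segment-snoc : ∀ {i j} → InShape sh i j → segment i j ≡ segment i (suc j) ++ [ (i , j) ]
  segment-snoc {i} {j} inShape = begin
    map (i ,_) (filter (j ≤?_) (downFrom (row sh i)))              ≡⟨ cong (map (i ,_)) (filter-≤-downFrom-< j (row sh i) inShape) ⟩
    map (i ,_) (filter (suc j ≤?_) (downFrom (row sh i)) ++ [ j ]) ≡⟨ map-++ (i ,_) _ [ j ] ⟩
    segment i (suc j) ++ [ (i , j) ]                               ∎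
    where open ≡-Reasoning

  u-below : ∀ {i j} → k ≤ i → u i j ≡ upTo n
  u-below {i} {j} k≤i = cong (λ rs → foldl step (upTo n) (concatMap (λ i′ → segment i′ j) rs)) (filter-≤-downFrom-≤ i k k≤i)

  u-row : ∀ i j → u i j ≡ foldl step (u (suc i) j) (segment i j)
  u-row i j with i <? k
  ... | yes i<k = begin
    foldl step (upTo n) (concatMap rowSeg (filter (i ≤?_) (downFrom k)))                          ≡⟨ cong (foldl step (upTo n) ∘ concatMap rowSeg) (filter-≤-downFrom-< i k i<k) ⟩
    foldl step (upTo n) (concatMap rowSeg (filter (suc i ≤?_) (downFrom k) ++ [ i ]))             ≡⟨ cong (foldl step (upTo n)) (concatMap-++ rowSeg (filter (suc i ≤?_) (downFrom k)) [ i ]) ⟩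
    foldl step (upTo n) (concatMap rowSeg (filter (suc i ≤?_) (downFrom k)) ++ segment i j ++ []) ≡⟨ foldl-++ step (upTo n) (concatMap rowSeg (filter (suc i ≤?_) (downFrom k))) (segment i j ++ []) ⟩
    foldl step (u (suc i) j) (segment i j ++ [])                                                  ≡⟨ cong (foldl step (u (suc i) j)) (++-identityʳ (segment i j)) ⟩
    foldl step (u (suc i) j) (segment i j)                                                        ∎
    where open ≡-Reasoning
          rowSeg = λ i′ → segment i′ j
  ... | no  i≮k = begin
    u i j                                  ≡⟨ u-below k≤i ⟩
    upTo n                                 ≡⟨ u-below (m≤n⇒m≤1+n k≤i) ⟨
    u (suc i) j                            ≡⟨ cong (foldl step (u (suc i) j)) (segment-empty (≤-trans (≤-reflexive (row-empty sh i k≤i)) z≤n)) ⟨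
    foldl step (u (suc i) j) (segment i j) ∎
    where open ≡-Reasoning
          k≤i = ≮⇒≥ i≮k

  u-box : ∀ {i j} → InShape sh i j → u i j ≡ step (uBefore i j) (i , j)
  u-box {i} {j} inShape = begin
    u i j                                                       ≡⟨ u-row i j ⟩
    foldl step (u (suc i) j) (segment i j)                      ≡⟨ cong (foldl step (u (suc i) j)) (segment-snoc inShape) ⟩
    foldl step (u (suc i) j) (segment i (suc j) ++ [ (i , j) ]) ≡⟨ foldl-++ step (u (suc i) j) (segment i (suc j)) _ ⟩
    step (uBefore i j) (i , j)                                  ∎
    where open ≡-Reasoning

  u-right-of-row : ∀ {i j} → row sh i ≤ j → u i j ≡ uBefore i j
  u-right-of-row {i} {j} row≤j = begin
    u i j                                  ≡⟨ u-row i j ⟩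
    foldl step (u (suc i) j) (segment i j) ≡⟨ cong (foldl step (u (suc i) j)) (segment-empty row≤j) ⟩
    u (suc i) j                            ≡⟨ cong (foldl step (u (suc i) j)) (segment-empty (m≤n⇒m≤1+n row≤j)) ⟨
    uBefore i j                            ∎
    where open ≡-Reasoning

  take-u≡take-uBefore : ∀ i j → take (gap j + i) (u i j) ≡ take (gap j + i) (uBefore i j)
  take-u≡take-uBefore i j with j <? row sh i
  ... | yes inShape = begin
    take (gap j + i) (u i j)                      ≡⟨ cong (take _) (u-box inShape) ⟩
    take (gap j + i) (step (uBefore i j) (i , j)) ≡⟨ take-step-beyond ⟩
    take (gap j + i) (uBefore i j)                ∎
    where
    open ≡-Reasoning
    take-step-beyond : take (gap j + i) (step (uBefore i j) (i , j)) ≡ take (gap j + i) (uBefore i j)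
    take-step-beyond with hasStone (D i j)
    ... | true  = take-swapAt-beyond (pos (i , j)) _ (uBefore i j) (≤-reflexive (sym (pos≡gap+row (InShape⇒col<m sh inShape))))
    ... | false = refl
  ... | no  j≮row = cong (take _) (u-right-of-row (≮⇒≥ j≮row))

  take-uBefore≡take-u-suc : ∀ i j → take (gap j + suc i) (u (suc i) j) ≡ take (gap j + suc i) (u (suc i) (suc j))
                      → take (gap j + suc i) (uBefore i j) ≡ take (gap j + suc i) (u i (suc j))
  take-uBefore≡take-u-suc i j below = begin
    take T (foldl step (u (suc i) j) (segment i (suc j)))       ≡⟨ take-foldl-step _ _ left-of ⟩
    foldl step (take T (u (suc i) j)) (segment i (suc j))       ≡⟨ cong (λ w → foldl step w (segment i (suc j))) below ⟩
    foldl step (take T (u (suc i) (suc j))) (segment i (suc j)) ≡⟨ take-foldl-step _ _ left-of ⟨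
    take T (foldl step (u (suc i) (suc j)) (segment i (suc j))) ≡⟨ cong (take T) (u-row i (suc j)) ⟨
    take T (u i (suc j))                                        ∎
    where
    open ≡-Reasoning
    T = gap j + suc i
    left-of : All (λ b → suc (pos b) < T) (segment i (suc j))
    left-of = All.map (λ le → ≤-<-trans le (+-monoʳ-< (gap j) (n<1+n i))) (segment-left-of i j)

  -- The boxes of column j in rows ≥ i swap only positions ≥ gap j + i; d bounds the rows left.
  take-u≡take-u-suc : ∀ d i j → k ≤ d + i → take (gap j + i) (u i j) ≡ take (gap j + i) (u i (suc j))
  take-u≡take-u-suc zero    i j k≤i = cong (take _) (trans (u-below k≤i) (sym (u-below k≤i)))
  take-u≡take-u-suc (suc d) i j k≤  = begin
    take (gap j + i) (u i j)       ≡⟨ take-u≡take-uBefore i j ⟩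
    take (gap j + i) (uBefore i j) ≡⟨ take-≤-cong (+-monoʳ-≤ (gap j) (n≤1+n i)) (take-uBefore≡take-u-suc i j below) ⟩
    take (gap j + i) (u i (suc j)) ∎
    where
    open ≡-Reasoning
    below = take-u≡take-u-suc d (suc i) j (subst (k ≤_) (sym (+-suc d i)) k≤)

  length-uBefore : ∀ i j → length (uBefore i j) ≡ n
  length-uBefore i j = begin
    length (uBefore i j) ≡⟨ length-foldl-step _ (segment i (suc j)) ⟩
    length (u (suc i) j) ≡⟨ length-foldl-step (upTo n) (boxesFrom (suc i) j) ⟩
    length (upTo n)      ≡⟨ length-upTo n ⟩
    n                    ∎
    where open ≡-Reasoning

  suc-pos<length-uBefore : ∀ {i j} → InShape sh i j → suc (pos (i , j)) < length (uBefore i j)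
  suc-pos<length-uBefore {i} {j} inShape = subst (_ <_) (sym (length-uBefore i j)) (suc-pos<n inShape)

  fromRight≢fromBelow : ∀ {i j} → InShape sh i j → fromRight i j ≢ fromBelow i j
  fromRight≢fromBelow {i} {j} inShape = Unique⇒at≢at-suc (pos (i , j)) (uBefore i j) unique (suc-pos<length-uBefore inShape)
    where unique = Unique-foldl-step _ (segment i (suc j)) (Unique-foldl-step (upTo n) (boxesFrom (suc i) j) (upTo⁺ n))

  fromRight≡at-u : ∀ {i j} → InShape sh i (suc j) → fromRight i j ≡ at (u i (suc j)) (suc (pos (i , suc j)))
  fromRight≡at-u {i} {j} inShape = begin
    at (uBefore i j) (pos (i , j))           ≡⟨ cong (at (uBefore i j)) (pos≡gap+row j<m) ⟩
    at (uBefore i j) (gap j + i)             ≡⟨ at-take T _ (uBefore i j) q<T ⟨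
    at (take T (uBefore i j)) (gap j + i)    ≡⟨ cong (λ w → at w (gap j + i)) (take-uBefore≡take-u-suc i j below) ⟩
    at (take T (u i (suc j))) (gap j + i)    ≡⟨ at-take T _ (u i (suc j)) q<T ⟩
    at (u i (suc j)) (gap j + i)             ≡⟨ cong (λ g → at (u i (suc j)) (g + i)) (m>n⇒m∸n≡suc[m∸suc[n]] sj<m) ⟩
    at (u i (suc j)) (suc (gap (suc j)) + i) ≡⟨ cong (at (u i (suc j)) ∘ suc) (pos≡gap+row sj<m) ⟨
    at (u i (suc j)) (suc (pos (i , suc j))) ∎
    where
    open ≡-Reasoning
    T = gap j + suc i
    sj<m = InShape⇒col<m sh inShape
    j<m = <-trans (n<1+n j) sj<m
    q<T = +-monoʳ-< (gap j) (n<1+n i)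
    below = take-u≡take-u-suc k (suc i) j (m≤m+n k (suc i))

  fromBelow≡at-u : ∀ {i j} → InShape sh (suc i) j → fromBelow i j ≡ at (u (suc i) j) (pos (suc i , j))
  fromBelow≡at-u {i} {j} inShape = begin
    at (uBefore i j) (suc (pos (i , j))) ≡⟨ cong (at (uBefore i j) ∘ suc) (pos≡gap+row j<m) ⟩
    at (uBefore i j) (suc (gap j + i))   ≡⟨ at-foldl-step-beyond _ _ (All.map s≤s (segment-left-of i j)) ⟩
    at (u (suc i) j) (suc (gap j + i))   ≡⟨ cong (at (u (suc i) j)) (+-suc (gap j) i) ⟨
    at (u (suc i) j) (gap j + suc i)     ≡⟨ cong (at (u (suc i) j)) (pos≡gap+row j<m) ⟨
    at (u (suc i) j) (pos (suc i , j))   ∎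
    where
    open ≡-Reasoning
    j<m = InShape⇒col<m sh inShape

  u≡swapAt-uBefore : ∀ {i j} → InShape sh i j → Stone i j → u i j ≡ swapAt (pos (i , j)) (uBefore i j)
  u≡swapAt-uBefore {i} {j} inShape stone = trans (u-box inShape) (cong (if_then swapAt (pos (i , j)) (uBefore i j) else uBefore i j) stone)

  u≡uBefore : ∀ {i j} → InShape sh i j → hasStone (D i j) ≡ false → u i j ≡ uBefore i j
  u≡uBefore {i} {j} inShape noStone = trans (u-box inShape) (cong (if_then swapAt (pos (i , j)) (uBefore i j) else uBefore i j) noStone)

  fromRight-stone : ∀ {i j} → InShape sh i (suc j) → Stone i (suc j) → fromRight i j ≡ fromRight i (suc j)
  fromRight-stone {i} {j} inShape stone = begin
    fromRight i j                             ≡⟨ fromRight≡at-u inShape ⟩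
    at (u i (suc j)) (suc p)                  ≡⟨ cong (λ w → at w (suc p)) (u≡swapAt-uBefore inShape stone) ⟩
    at (swapAt p (uBefore i (suc j))) (suc p) ≡⟨ at-swapAt-suc p (uBefore i (suc j)) (suc-pos<length-uBefore inShape) ⟩
    fromRight i (suc j)                       ∎
    where
    open ≡-Reasoning
    p = pos (i , suc j)

  fromRight-plus : ∀ {i j} → InShape sh i (suc j) → hasStone (D i (suc j)) ≡ false → fromRight i j ≡ fromBelow i (suc j)
  fromRight-plus {i} {j} inShape noStone =
    trans (fromRight≡at-u inShape) (cong (λ w → at w (suc (pos (i , suc j)))) (u≡uBefore inShape noStone))

  fromBelow-stone : ∀ {i j} → InShape sh (suc i) j → Stone (suc i) j → fromBelow i j ≡ fromBelow (suc i) j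
  fromBelow-stone {i} {j} inShape stone = begin
    fromBelow i j                       ≡⟨ fromBelow≡at-u inShape ⟩
    at (u (suc i) j) p                  ≡⟨ cong (λ w → at w p) (u≡swapAt-uBefore inShape stone) ⟩
    at (swapAt p (uBefore (suc i) j)) p ≡⟨ at-swapAt p (uBefore (suc i) j) (suc-pos<length-uBefore inShape) ⟩
    fromBelow (suc i) j                 ∎
    where
    open ≡-Reasoning
    p = pos (suc i , j)

  fromBelow-plus : ∀ {i j} → InShape sh (suc i) j → hasStone (D (suc i) j) ≡ false → fromBelow i j ≡ fromRight (suc i) j
  fromBelow-plus {i} {j} inShape noStone =
    trans (fromBelow≡at-u inShape) (cong (λ w → at w (pos (suc i , j))) (u≡uBefore inShape noStone))

  fromRight-along-stones : ∀ i j t → InShape sh i (j + t) → (∀ y → 0 < y → y ≤ t → Stone i (j + y))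
                         → fromRight i j ≡ fromRight i (j + t)
  fromRight-along-stones i j zero    _       _      = cong (fromRight i) (sym (+-identityʳ j))
  fromRight-along-stones i j (suc t) inShape stones = begin
    fromRight i j             ≡⟨ fromRight-along-stones i j t (<-trans (n<1+n _) inShape′) (λ y 0<y y≤t → stones y 0<y (m≤n⇒m≤1+n y≤t)) ⟩
    fromRight i (j + t)       ≡⟨ fromRight-stone inShape′ (subst (Stone i) (+-suc j t) (stones (suc t) z<s ≤-refl)) ⟩
    fromRight i (suc (j + t)) ≡⟨ cong (fromRight i) (+-suc j t) ⟨
    fromRight i (j + suc t)   ∎
    where
    open ≡-Reasoning
    inShape′ = subst (InShape sh i) (+-suc j t) inShape

  fromBelow-along-stones : ∀ i j t → InShape sh (i + t) j → (∀ x → 0 < x → x ≤ t → Stone (i + x) j)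
                         → fromBelow i j ≡ fromBelow (i + t) j
  fromBelow-along-stones i j zero    _       _      = cong (λ i′ → fromBelow i′ j) (sym (+-identityʳ i))
  fromBelow-along-stones i j (suc t) inShape stones = begin
    fromBelow i j             ≡⟨ fromBelow-along-stones i j t (InShape-upLeft sh (n≤1+n _) ≤-refl inShape′) (λ x 0<x x≤t → stones x 0<x (m≤n⇒m≤1+n x≤t)) ⟩
    fromBelow (i + t) j       ≡⟨ fromBelow-stone inShape′ (subst (λ i′ → Stone i′ j) (+-suc i t) (stones (suc t) z<s ≤-refl)) ⟩
    fromBelow (suc (i + t)) j ≡⟨ cong (λ i′ → fromBelow i′ j) (+-suc i t) ⟨
    fromBelow (i + suc t) j   ∎
    where
    open ≡-Reasoning
    inShape′ = subst (λ i′ → InShape sh i′ j) (+-suc i t) inShape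

  stonesOffCorners : ∀ r c a d → D (r + a) (c + d) ≡ white
    → (∀ x y → x ≤ a → y ≤ d → ¬ (x ≡ 0 × y ≡ 0) → ¬ (x ≡ 0 × y ≡ d) → ¬ (x ≡ a × y ≡ 0) → ¬ (x ≡ a × y ≡ d)
         → D (r + x) (c + y) ≡ white)
    → ∀ x y → x ≤ a → y ≤ d → ¬ (x ≡ 0 × y ≡ 0) → ¬ (x ≡ 0 × y ≡ d) → ¬ (x ≡ a × y ≡ 0) → Stone (r + x) (c + y)
  stonesOffCorners r c a d bottomRight whites x y x≤a y≤d ¬tl ¬tr ¬bl with x ≟ a | y ≟ d
  ... | yes refl | yes refl = cong hasStone bottomRight
  ... | yes refl | no  y≢d  = cong hasStone (whites x y x≤a y≤d ¬tl ¬tr ¬bl (y≢d ∘ proj₂))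
  ... | no  x≢a  | _        = cong hasStone (whites x y x≤a y≤d ¬tl ¬tr ¬bl (x≢a ∘ proj₁))

  module Go (go : IsGoDiagram n k sh D) where

    uInB≡uBefore : ∀ {i j} → InShape sh i j → uInB n k sh D i j ≡ uBefore i j
    uInB≡uBefore {i} {j} inShape = trans (cong (λ w → step w (i , j)) (u-box inShape)) (step-involutive (uBefore i j) (i , j))

    black⇔descent : ∀ {i j} → InShape sh i j → D i j ≡ black ⇔ fromBelow i j < fromRight i j
    black⇔descent {i} {j} inShape = mk⇔
      (λ isBlack → Equivalence.to descent (subst LengthDrops (uInB≡uBefore inShape) (proj₁ (go i j inShape) isBlack)))
      (λ isDescent → proj₂ (go i j inShape) (subst LengthDrops (sym (uInB≡uBefore inShape)) (Equivalence.from descent isDescent)))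
      where
      LengthDrops : Perm → Set
      LengthDrops w = len (w ·s label m i j) < len w
      descent = len-swapAt<⇔descent (pos (i , j)) (uBefore i j) (suc-pos<length-uBefore inShape)

    fromRight<fromBelow : ∀ {i j} → InShape sh i j → D i j ≢ black → fromRight i j < fromBelow i j
    fromRight<fromBelow inShape notBlack =
      ≤∧≢⇒< (≮⇒≥ (notBlack ∘ Equivalence.from (black⇔descent inShape))) (fromRight≢fromBelow inShape)

    turn-left : ∀ {i j} → InShape sh i (suc j) → BlackOrPlus (D i (suc j)) → fromBelow i (suc j) ≤ fromRight i j
    turn-left inShape (inj₁ isBlack) = ≤-trans (<⇒≤ (Equivalence.to (black⇔descent inShape) isBlack))
                                               (≤-reflexive (sym (fromRight-stone inShape (cong hasStone isBlack))))
    turn-left inShape (inj₂ isPlus)  = ≤-reflexive (sym (fromRight-plus inShape (cong hasStone isPlus)))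

    turn-up : ∀ {i j} → InShape sh (suc i) j → BlackOrPlus (D (suc i) j) → fromBelow i j ≤ fromRight (suc i) j
    turn-up inShape (inj₁ isBlack) = ≤-trans (≤-reflexive (fromBelow-stone inShape (cong hasStone isBlack)))
                                             (<⇒≤ (Equivalence.to (black⇔descent inShape) isBlack))
    turn-up inShape (inj₂ isPlus)  = ≤-reflexive (fromBelow-plus inShape (cong hasStone isPlus))

    topLeft-black : ∀ r c a d → InShape sh (r + suc a) (c + suc d)
      → (∀ x y → x ≤ suc a → y ≤ suc d → ¬ (x ≡ 0 × y ≡ 0) → ¬ (x ≡ 0 × y ≡ suc d) → ¬ (x ≡ suc a × y ≡ 0) → Stone (r + x) (c + y))
      → BlackOrPlus (D r (c + suc d)) → BlackOrPlus (D (r + suc a) c) → D (r + suc a) (c + suc d) ≢ black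
      → D r c ≡ black
    topLeft-black r c a d inShape stones topRight bottomLeft notBlack =
      Equivalence.from (black⇔descent (within (m≤m+n r _) (m≤m+n c _))) $ begin-strict
      fromBelow r c                     ≡⟨ fromBelow-along-stones r c a (within (+-monoʳ-≤ r (n≤1+n a)) (m≤m+n c _)) left ⟩
      fromBelow (r + a) c               ≤⟨ turn-up (within (≤-reflexive (sym (+-suc r a))) (m≤m+n c _)) (subst (λ i → BlackOrPlus (D i c)) (+-suc r a) bottomLeft) ⟩
      fromRight (suc (r + a)) c         ≡⟨ cong (λ i → fromRight i c) (+-suc r a) ⟨
      fromRight (r + suc a) c           ≡⟨ fromRight-along-stones (r + suc a) c (suc d) inShape bottom ⟩
      fromRight (r + suc a) (c + suc d) <⟨ fromRight<fromBelow inShape notBlack ⟩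
      fromBelow (r + suc a) (c + suc d) ≡⟨ fromBelow-along-stones r (c + suc d) (suc a) inShape right ⟨
      fromBelow r (c + suc d)           ≡⟨ cong (fromBelow r) (+-suc c d) ⟩
      fromBelow r (suc (c + d))         ≤⟨ turn-left (within (m≤m+n r _) (≤-reflexive (sym (+-suc c d)))) (subst (BlackOrPlus ∘ D r) (+-suc c d) topRight) ⟩
      fromRight r (c + d)               ≡⟨ fromRight-along-stones r c d (within (m≤m+n r _) (+-monoʳ-≤ c (n≤1+n d))) top ⟨
      fromRight r c                     ∎
      where
      open ≤-Reasoning
      within : ∀ {i j} → i ≤ r + suc a → j ≤ c + suc d → InShape sh i j
      within i≤ j≤ = InShape-upLeft sh i≤ j≤ inShape
      top : ∀ y → 0 < y → y ≤ d → Stone r (c + y)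
      top y 0<y y≤d = subst (λ i → Stone i (c + y)) (+-identityʳ r)
        (stones 0 y z≤n (m≤n⇒m≤1+n y≤d) (n>0⇒n≢0 0<y ∘ proj₂) (<⇒≢ (s≤s y≤d) ∘ proj₂) (0≢1+n ∘ proj₁))
      left : ∀ x → 0 < x → x ≤ a → Stone (r + x) c
      left x 0<x x≤a = subst (Stone (r + x)) (+-identityʳ c)
        (stones x 0 (m≤n⇒m≤1+n x≤a) z≤n (n>0⇒n≢0 0<x ∘ proj₁) (n>0⇒n≢0 0<x ∘ proj₁) (<⇒≢ (s≤s x≤a) ∘ proj₁))
      right : ∀ x → 0 < x → x ≤ suc a → Stone (r + x) (c + suc d)
      right x 0<x x≤a = stones x (suc d) x≤a ≤-refl (n>0⇒n≢0 0<x ∘ proj₁) (n>0⇒n≢0 0<x ∘ proj₁) (1+n≢0 ∘ proj₂)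
      bottom : ∀ y → 0 < y → y ≤ suc d → Stone (r + suc a) (c + y)
      bottom y 0<y y≤d = stones (suc a) y ≤-refl y≤d (1+n≢0 ∘ proj₁) (1+n≢0 ∘ proj₁) (n>0⇒n≢0 0<y ∘ proj₂)

mainTheorem13 : (n k : ℕ) → 0 < k → k < n → (sh : Shape k (n ∸ k)) → (D : Diagram)
  → IsGoDiagram n k sh D
  → ¬ (Σ[ r ∈ ℕ ] Σ[ c ∈ ℕ ] Σ[ a ∈ ℕ ] Σ[ d ∈ ℕ ]
        (1 ≤ a) × (1 ≤ d)
      × (∀ x y → x ≤ a → y ≤ d → InShape sh (r + x) (c + y))
      × (D r c ≡ white ⊎ D r c ≡ plus)
      × (D r (c + d) ≡ black ⊎ D r (c + d) ≡ plus)
      × (D (r + a) c ≡ black ⊎ D (r + a) c ≡ plus)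
      × (D (r + a) (c + d) ≡ white)
      × (∀ x y → x ≤ a → y ≤ d
           → ¬ (x ≡ 0 × y ≡ 0) → ¬ (x ≡ 0 × y ≡ d)
           → ¬ (x ≡ a × y ≡ 0) → ¬ (x ≡ a × y ≡ d)
           → D (r + x) (c + y) ≡ white))
mainTheorem13 n k _ k<n sh D go (r , c , suc a , suc d , _ , _ , inShape , topLeft , topRight , bottomLeft , bottomRight , whites) =
  whiteOrPlus⇒≢black topLeft
    (topLeft-black r c a d (inShape (suc a) (suc d) ≤-refl ≤-refl)
       (stonesOffCorners r c (suc a) (suc d) bottomRight whites) topRight bottomLeft (whiteOrPlus⇒≢black (inj₁ bottomRight)))
  where
  open Wiring n k (<⇒≤ k<n) sh D
  open Go go
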